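{- The variety of pointed Brouwerian algebras and the variety of multiplicatively integral idempotent commutative residuated $\ell$-bimonoids are term equivalent via the correspondence $x\cdot y := x\wedge y$ and $x+y := (0\rightarrow(x\wedge y))\wedge(x\vee y)$ (the lattice operations, the constants $1$, $0$ and the operation $\rightarrow$ being kept).
   Context: A Brouwerian algebra $\langle A,\vee,\wedge,1,\rightarrow\rangle$ is a distributive lattice with top element $1$ and a binary operation satisfying $x\wedge y\leq z \iff y\leq x\rightarrow z$; a pointed Brouwerian algebra is one with an additional arbitrary constant $0$. A commutative $\ell$-bimonoid $\langle A,\vee,\wedge,\cdot,1,+,0\rangle$ is a lattice with two commutative monoid operations $\cdot$ (unit $1$) and $+$ (unit $0$) such that $x\cdot(y\vee z)=(x\cdot y)\vee(x\cdot z)$, $x+(y\wedge z)=(x+y)\wedge(x+z)$ and the hemidistributive law $x\cdot(y+z)\leq (x\cdot y)+z$ holds (monotonicity of both operations follows). It is residuated if it has a binary operation $\rightarrow$ with $x\cdot y\leq z\iff y\leq x\rightarrow z$; multiplicatively integral if $x\leq 1$ for all $x$; idempotent if $x\cdot x=x$ and $x+x=x$ for all $x$. -}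

module Defs where

open import Level using (Level)
open import Data.Product using (_×_)
open import Function.Bundles using (_⇔_)
open import Relation.Binary.PropositionalEquality using (_≡_)
open import Algebra.Core using (Op₂)
open import Algebra.Structures using (IsCommutativeMonoid)
open import Algebra.Lattice.Structures using (IsLattice; IsDistributiveLattice)

module _ {a : Level} {A : Set a} where

  LatLeq : Op₂ A → A → A → Set a
  LatLeq _∧_ x y = x ∧ y ≡ x

  record IsPointedBrouwerian (_∨_ _∧_ : Op₂ A) (one : A) (_⇒_ : Op₂ A) (zero : A) : Set a where
    field
      isDistributiveLattice : IsDistributiveLattice _≡_ _∨_ _∧_
      top : ∀ x → LatLeq _∧_ x one
      residuation : ∀ x y z → LatLeq _∧_ (x ∧ y) z ⇔ LatLeq _∧_ y (x ⇒ z)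

  record IsMIICRLBimonoid (_∨_ _∧_ _·_ : Op₂ A) (one : A) (_+_ : Op₂ A) (zero : A) (_⇒_ : Op₂ A) : Set a where
    field
      isLattice : IsLattice _≡_ _∨_ _∧_
      ·-isCommutativeMonoid : IsCommutativeMonoid _≡_ _·_ one
      +-isCommutativeMonoid : IsCommutativeMonoid _≡_ _+_ zero
      ·-distrib-∨ : ∀ x y z → x · (y ∨ z) ≡ (x · y) ∨ (x · z)
      +-distrib-∧ : ∀ x y z → x + (y ∧ z) ≡ (x + y) ∧ (x + z)
      hemidistributive : ∀ x y z → LatLeq _∧_ (x · (y + z)) ((x · y) + z)
      residuated : ∀ x y z → LatLeq _∧_ (x · y) z ⇔ LatLeq _∧_ y (x ⇒ z)
      integral : ∀ x → LatLeq _∧_ x one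
      ·-idem : ∀ x → x · x ≡ x
      +-idem : ∀ x → x + x ≡ x

  brTimes : (_∧_ : Op₂ A) → Op₂ A
  brTimes _∧_ x y = x ∧ y

  brPlus : (_∨_ _∧_ _⇒_ : Op₂ A) (zero : A) → Op₂ A
  brPlus _∨_ _∧_ _⇒_ zero x y = (zero ⇒ (x ∧ y)) ∧ (x ∨ y)

-- In a pointed Brouwerian algebra, x ⊕ y := (0 → x ∧ y) ∧ (x ∨ y) is the largest w ≤ x ∨ y
-- with 0 ∧ w ≤ x ∧ y, and all bimonoid laws of ⊕ follow from this universal property and
-- distributivity. Conversely, in an integral idempotent bimonoid x · y lies below x · 1 and
-- 1 · y, and above (x ∧ y) · (x ∧ y) = x ∧ y, so · is ∧. Hemidistributivity with the unit 0
-- then gives 0 ∧ (x + y) ≤ x ∧ y, i.e. x + y ≤ 0 → x ∧ y, and z ∧ x ≤ y + x whenever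
-- z ∧ 0 ≤ y; splitting (0 → x ∧ y) ∧ (x ∨ y) along x ∨ y yields the reverse inequality.
module Submission where

open import Defs
open import Level using (Level)
open import Data.Product using (_×_; _,_)
open import Function.Base using (_∘_)
open import Function.Bundles using (_⇔_; mk⇔; Equivalence)
open Equivalence using (to; from)
open import Relation.Binary.PropositionalEquality using (_≡_; sym; trans; cong; cong₂; subst; subst₂; isEquivalence; module ≡-Reasoning)
open import Algebra.Core using (Op₂)
open import Algebra.Lattice.Bundles using (Lattice)
open import Algebra.Lattice.Structures using (IsLattice; IsDistributiveLattice)
import Algebra.Lattice.Properties.Lattice as AlgLatticeProperties
import Relation.Binary.Lattice as OrderLattice
import Relation.Binary.Lattice.Properties.MeetSemilattice as MeetSemilatticeProperties
import Relation.Binary.Lattice.Properties.JoinSemilattice as JoinSemilatticeProperties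
import Relation.Binary.Lattice.Properties.DistributiveLattice as DistributiveLatticeProperties
import Relation.Binary.Reasoning.PartialOrder as PosetReasoning
open import Algebra.Bundles using (CommutativeSemigroup)
open import Algebra.Structures using (IsCommutativeBand; IsCommutativeMonoid)
import Algebra.Properties.CommutativeSemigroup as CommutativeSemigroupProperties

module LatticeOrder {a : Level} {A : Set a} {_∨_ _∧_ : Op₂ A}
  (isLattice : IsLattice _≡_ _∨_ _∧_) where

  lattice : Lattice a a
  lattice = record { isLattice = isLattice }

  orderLattice : OrderLattice.Lattice a a a
  orderLattice = AlgLatticeProperties.∨-∧-orderTheoreticLattice lattice

  open OrderLattice.Lattice orderLattice public
    using (_≤_; antisym; x≤x∨y; y≤x∨y; ∨-least; x∧y≤x; x∧y≤y; ∧-greatest; poset)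
    renaming (refl to ≤-refl; trans to ≤-trans; reflexive to ≤-reflexive)
  open MeetSemilatticeProperties (OrderLattice.Lattice.meetSemilattice orderLattice) public
    using (∧-monotonic; ∧-idempotent)
  open JoinSemilatticeProperties (OrderLattice.Lattice.joinSemilattice orderLattice) public
    using (x≤y⇒x∨y≈y; ∨-monotonic; ∨-idempotent)

  ∨-commutativeSemigroup : CommutativeSemigroup a a
  ∨-commutativeSemigroup = record
    { isCommutativeSemigroup = IsCommutativeBand.isCommutativeSemigroup
        (AlgLatticeProperties.∨-isSemilattice lattice) }

  ∧-commutativeSemigroup : CommutativeSemigroup a a
  ∧-commutativeSemigroup = record
    { isCommutativeSemigroup = IsCommutativeBand.isCommutativeSemigroup
        (AlgLatticeProperties.∧-isSemilattice lattice) }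

  open CommutativeSemigroupProperties ∨-commutativeSemigroup public
    using () renaming (xy∙z≈zy∙x to ∨-rotate)
  open CommutativeSemigroupProperties ∧-commutativeSemigroup public
    using () renaming (xy∙z≈zy∙x to ∧-rotate)

  -- Here x ≤ x′ unfolds to x ≡ x ∧ x′, the mirror image of LatLeq.
  LatLeq⇔≤ : ∀ {x y} → LatLeq _∧_ x y ⇔ x ≤ y
  LatLeq⇔≤ = mk⇔ sym sym

  ∧-distribˡ-∨⇒orderDistributiveLattice : (∀ x y z → x ∧ (y ∨ z) ≡ (x ∧ y) ∨ (x ∧ z)) →
                                           OrderLattice.DistributiveLattice a a a
  ∧-distribˡ-∨⇒orderDistributiveLattice ∧-distribˡ-∨ = record
    { isDistributiveLattice = record
      { isLattice = OrderLattice.Lattice.isLattice orderLattice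
      ; ∧-distribˡ-∨ = ∧-distribˡ-∨
      }
    }

  ∧-distribˡ-∨⇒isDistributiveLattice : (∀ x y z → x ∧ (y ∨ z) ≡ (x ∧ y) ∨ (x ∧ z)) →
                                        IsDistributiveLattice _≡_ _∨_ _∧_
  ∧-distribˡ-∨⇒isDistributiveLattice ∧-distribˡ-∨ = record
    { isLattice = isLattice
    ; ∨-distrib-∧ = ∨-distrib-∧
    ; ∧-distrib-∨ = ∧-distrib-∨
    }
    where
    open DistributiveLatticeProperties (∧-distribˡ-∨⇒orderDistributiveLattice ∧-distribˡ-∨)

  module Residuated {_⇒_ : Op₂ A}
    (residuation : ∀ x y z → LatLeq _∧_ (x ∧ y) z ⇔ LatLeq _∧_ y (x ⇒ z)) where

    transpose-⇒ : ∀ {x y z} → x ∧ y ≤ z → y ≤ x ⇒ z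
    transpose-⇒ {x} {y} {z} = to LatLeq⇔≤ ∘ to (residuation x y z) ∘ from LatLeq⇔≤

    transpose-∧ : ∀ {x y z} → y ≤ x ⇒ z → x ∧ y ≤ z
    transpose-∧ {x} {y} {z} = to LatLeq⇔≤ ∘ from (residuation x y z) ∘ from LatLeq⇔≤

  module Distributive (∧-distribˡ-∨ : ∀ x y z → x ∧ (y ∨ z) ≡ (x ∧ y) ∨ (x ∧ z)) where

    ≤∨-split : ∀ {w x y z} → w ≤ x ∨ y → w ∧ x ≤ z → w ∧ y ≤ z → w ≤ z
    ≤∨-split {w} {x} {y} {z} w≤x∨y wx≤z wy≤z = begin
      w                  ≡⟨ w≤x∨y ⟩
      w ∧ (x ∨ y)        ≡⟨ ∧-distribˡ-∨ w x y ⟩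
      (w ∧ x) ∨ (w ∧ y)  ≤⟨ ∨-least wx≤z wy≤z ⟩
      z                  ∎
      where open PosetReasoning poset

module PointedBrouwerian {a : Level} {A : Set a} {_∨_ _∧_ _⇒_ : Op₂ A} {one 0# : A}
  (isPointedBrouwerian : IsPointedBrouwerian _∨_ _∧_ one _⇒_ 0#) where

  open IsPointedBrouwerian isPointedBrouwerian
  open IsDistributiveLattice isDistributiveLattice
    using (isLattice; ∧-comm; ∨-comm; ∧-distribˡ-∨; ∨-distribˡ-∧)
  open LatticeOrder isLattice
  open Distributive ∧-distribˡ-∨
  open Residuated residuation

  _⊕_ : Op₂ A
  _⊕_ = brPlus _∨_ _∧_ _⇒_ 0#

  ⊕-greatest : ∀ {w x y} → w ≤ x ∨ y → 0# ∧ w ≤ x ∧ y → w ≤ x ⊕ y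
  ⊕-greatest w≤x∨y 0w≤x∧y = ∧-greatest (transpose-⇒ 0w≤x∧y) w≤x∨y

  x⊕y≤x∨y : ∀ x y → x ⊕ y ≤ x ∨ y
  x⊕y≤x∨y x y = x∧y≤y (0# ⇒ (x ∧ y)) (x ∨ y)

  0∧x⊕y≤x∧y : ∀ x y → 0# ∧ (x ⊕ y) ≤ x ∧ y
  0∧x⊕y≤x∧y x y = transpose-∧ (x∧y≤x (0# ⇒ (x ∧ y)) (x ∨ y))

  ⊕-comm : ∀ x y → x ⊕ y ≡ y ⊕ x
  ⊕-comm x y = cong₂ _∧_ (cong (0# ⇒_) (∧-comm x y)) (∨-comm x y)

  ⊕-identityʳ : ∀ x → x ⊕ 0# ≡ x
  ⊕-identityʳ x = antisym
    (≤∨-split (x⊕y≤x∨y x 0#) (x∧y≤y (x ⊕ 0#) x) (begin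
      (x ⊕ 0#) ∧ 0#  ≡⟨ ∧-comm (x ⊕ 0#) 0# ⟩
      0# ∧ (x ⊕ 0#)  ≤⟨ 0∧x⊕y≤x∧y x 0# ⟩
      x ∧ 0#         ≤⟨ x∧y≤x x 0# ⟩
      x              ∎))
    (⊕-greatest (x≤x∨y x 0#) (≤-reflexive (∧-comm 0# x)))
    where open PosetReasoning poset

  ⊕-identityˡ : ∀ x → 0# ⊕ x ≡ x
  ⊕-identityˡ x = trans (⊕-comm 0# x) (⊕-identityʳ x)

  ⊕-idem : ∀ x → x ⊕ x ≡ x
  ⊕-idem x = antisym
    (≤-trans (x⊕y≤x∨y x x) (≤-reflexive (∨-idempotent x)))
    (⊕-greatest (≤-reflexive (sym (∨-idempotent x)))
                (≤-trans (x∧y≤y 0# x) (≤-reflexive (sym (∧-idempotent x)))))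

  ⊕-monoʳ : ∀ {x y y′} → y ≤ y′ → x ⊕ y ≤ x ⊕ y′
  ⊕-monoʳ {x} {y} y≤y′ = ⊕-greatest
    (≤-trans (x⊕y≤x∨y x y) (∨-monotonic ≤-refl y≤y′))
    (≤-trans (0∧x⊕y≤x∧y x y) (∧-monotonic ≤-refl y≤y′))

  ⊕-distribˡ-∧ : ∀ x y z → x ⊕ (y ∧ z) ≡ (x ⊕ y) ∧ (x ⊕ z)
  ⊕-distribˡ-∧ x y z = antisym
    (∧-greatest (⊕-monoʳ (x∧y≤x y z)) (⊕-monoʳ (x∧y≤y y z)))
    (⊕-greatest
      (≤-trans (∧-monotonic (x⊕y≤x∨y x y) (x⊕y≤x∨y x z))
               (≤-reflexive (sym (∨-distribˡ-∧ x y z))))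
      (∧-greatest (≤-trans 0w≤x∧y (x∧y≤x x y))
                  (∧-greatest (≤-trans 0w≤x∧y (x∧y≤y x y)) (≤-trans 0w≤x∧z (x∧y≤y x z)))))
    where
    0w≤x∧y : 0# ∧ ((x ⊕ y) ∧ (x ⊕ z)) ≤ x ∧ y
    0w≤x∧y = ≤-trans (∧-monotonic ≤-refl (x∧y≤x (x ⊕ y) (x ⊕ z))) (0∧x⊕y≤x∧y x y)
    0w≤x∧z : 0# ∧ ((x ⊕ y) ∧ (x ⊕ z)) ≤ x ∧ z
    0w≤x∧z = ≤-trans (∧-monotonic ≤-refl (x∧y≤y (x ⊕ y) (x ⊕ z))) (0∧x⊕y≤x∧y x z)

  ∧-⊕-hemidistrib : ∀ x y z → x ∧ (y ⊕ z) ≤ (x ∧ y) ⊕ z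
  ∧-⊕-hemidistrib x y z = ⊕-greatest
    (≤∨-split (≤-trans (x∧y≤y x (y ⊕ z)) (x⊕y≤x∨y y z))
      (≤-trans (∧-monotonic (x∧y≤x x (y ⊕ z)) ≤-refl) (x≤x∨y (x ∧ y) z))
      (≤-trans (x∧y≤y (x ∧ (y ⊕ z)) z) (y≤x∨y (x ∧ y) z)))
    (∧-greatest
      (∧-greatest (≤-trans (x∧y≤y 0# (x ∧ (y ⊕ z))) (x∧y≤x x (y ⊕ z)))
                  (≤-trans 0w≤y∧z (x∧y≤x y z)))
      (≤-trans 0w≤y∧z (x∧y≤y y z)))
    where
    0w≤y∧z : 0# ∧ (x ∧ (y ⊕ z)) ≤ y ∧ z
    0w≤y∧z = ≤-trans (∧-monotonic ≤-refl (x∧y≤y x (y ⊕ z))) (0∧x⊕y≤x∧y y z)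

  x⊕y⊕z≤x∨y∨z : ∀ x y z → (x ⊕ y) ⊕ z ≤ (x ∨ y) ∨ z
  x⊕y⊕z≤x∨y∨z x y z = ≤-trans (x⊕y≤x∨y (x ⊕ y) z) (∨-monotonic (x⊕y≤x∨y x y) ≤-refl)

  0∧x⊕y⊕z≤x∧y∧z : ∀ x y z → 0# ∧ ((x ⊕ y) ⊕ z) ≤ (x ∧ y) ∧ z
  0∧x⊕y⊕z≤x∧y∧z x y z = ∧-greatest
    (≤-trans (∧-greatest (x∧y≤x 0# ((x ⊕ y) ⊕ z)) (≤-trans 0w≤x⊕y∧z (x∧y≤x (x ⊕ y) z)))
             (0∧x⊕y≤x∧y x y))
    (≤-trans 0w≤x⊕y∧z (x∧y≤y (x ⊕ y) z))
    where
    0w≤x⊕y∧z : 0# ∧ ((x ⊕ y) ⊕ z) ≤ (x ⊕ y) ∧ z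
    0w≤x⊕y∧z = 0∧x⊕y≤x∧y (x ⊕ y) z

  ⊕⊕-greatest : ∀ {w x y z} → w ≤ (x ∨ y) ∨ z → 0# ∧ w ≤ (x ∧ y) ∧ z → w ≤ (x ⊕ y) ⊕ z
  ⊕⊕-greatest {w} {x} {y} {z} w≤x∨y∨z 0w≤x∧y∧z = ⊕-greatest
    (≤∨-split w≤x∨y∨z
      (≤-trans (⊕-greatest (x∧y≤y w (x ∨ y))
                 (≤-trans (∧-monotonic ≤-refl (x∧y≤x w (x ∨ y))) 0w≤x∧y))
               (x≤x∨y (x ⊕ y) z))
      (≤-trans (x∧y≤y w z) (y≤x∨y (x ⊕ y) z)))
    (∧-greatest
      (⊕-greatest (≤-trans 0w≤x∧y (≤-trans (x∧y≤x x y) (x≤x∨y x y)))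
                  (≤-trans (x∧y≤y 0# (0# ∧ w)) 0w≤x∧y))
      (≤-trans 0w≤x∧y∧z (x∧y≤y (x ∧ y) z)))
    where
    0w≤x∧y : 0# ∧ w ≤ x ∧ y
    0w≤x∧y = ≤-trans 0w≤x∧y∧z (x∧y≤x (x ∧ y) z)

  ⊕-rotate : ∀ x y z → (x ⊕ y) ⊕ z ≡ (z ⊕ y) ⊕ x
  ⊕-rotate x y z = antisym (rotate≤ x y z) (rotate≤ z y x)
    where
    rotate≤ : ∀ x y z → (x ⊕ y) ⊕ z ≤ (z ⊕ y) ⊕ x
    rotate≤ x y z = ⊕⊕-greatest
      (≤-trans (x⊕y⊕z≤x∨y∨z x y z) (≤-reflexive (∨-rotate x y z)))
      (≤-trans (0∧x⊕y⊕z≤x∧y∧z x y z) (≤-reflexive (∧-rotate x y z)))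

  ⊕-assoc : ∀ x y z → (x ⊕ y) ⊕ z ≡ x ⊕ (y ⊕ z)
  ⊕-assoc x y z = begin
    (x ⊕ y) ⊕ z  ≡⟨ ⊕-rotate x y z ⟩
    (z ⊕ y) ⊕ x  ≡⟨ ⊕-comm (z ⊕ y) x ⟩
    x ⊕ (z ⊕ y)  ≡⟨ cong (x ⊕_) (⊕-comm z y) ⟩
    x ⊕ (y ⊕ z)  ∎
    where open ≡-Reasoning

  ∧-isCommutativeMonoid : IsCommutativeMonoid _≡_ _∧_ one
  ∧-isCommutativeMonoid = record
    { isMonoid = record
      { isSemigroup = IsCommutativeBand.isSemigroup (AlgLatticeProperties.∧-isSemilattice lattice)
      ; identity = (λ x → trans (∧-comm one x) (top x)) , top
      }
    ; comm = ∧-comm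
    }

  ⊕-isCommutativeMonoid : IsCommutativeMonoid _≡_ _⊕_ 0#
  ⊕-isCommutativeMonoid = record
    { isMonoid = record
      { isSemigroup = record
        { isMagma = record { isEquivalence = isEquivalence ; ∙-cong = cong₂ _⊕_ }
        ; assoc = ⊕-assoc
        }
      ; identity = ⊕-identityˡ , ⊕-identityʳ
      }
    ; comm = ⊕-comm
    }

  isMIICRLBimonoid : IsMIICRLBimonoid _∨_ _∧_ (brTimes _∧_) one _⊕_ 0# _⇒_
  isMIICRLBimonoid = record
    { isLattice = isLattice
    ; ·-isCommutativeMonoid = ∧-isCommutativeMonoid
    ; +-isCommutativeMonoid = ⊕-isCommutativeMonoid
    ; ·-distrib-∨ = ∧-distribˡ-∨
    ; +-distrib-∧ = ⊕-distribˡ-∧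
    ; hemidistributive = λ x y z → from LatLeq⇔≤ (∧-⊕-hemidistrib x y z)
    ; residuated = residuation
    ; integral = top
    ; ·-idem = ∧-idempotent
    ; +-idem = ⊕-idem
    }

module MIICRLBimonoid {a : Level} {A : Set a} {_∨_ _∧_ _·_ _+_ _⇒_ : Op₂ A} {one 0# : A}
  (isMIICRLBimonoid : IsMIICRLBimonoid _∨_ _∧_ _·_ one _+_ 0# _⇒_) where

  open IsMIICRLBimonoid isMIICRLBimonoid
  open IsLattice isLattice using (∧-comm)
  open LatticeOrder isLattice
  module · = IsCommutativeMonoid ·-isCommutativeMonoid
  module + = IsCommutativeMonoid +-isCommutativeMonoid

  ·-monoʳ : ∀ {x y y′} → y ≤ y′ → x · y ≤ x · y′
  ·-monoʳ {x} {y} {y′} y≤y′ = begin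
    x · y              ≤⟨ x≤x∨y (x · y) (x · y′) ⟩
    (x · y) ∨ (x · y′) ≡⟨ ·-distrib-∨ x y y′ ⟨
    x · (y ∨ y′)       ≡⟨ cong (x ·_) (x≤y⇒x∨y≈y y≤y′) ⟩
    x · y′             ∎
    where open PosetReasoning poset

  ·-monotonic : ∀ {x x′ y y′} → x ≤ x′ → y ≤ y′ → x · y ≤ x′ · y′
  ·-monotonic {x} {x′} {y} {y′} x≤x′ y≤y′ = ≤-trans (·-monoʳ y≤y′)
    (≤-trans (≤-reflexive (·.comm x y′)) (≤-trans (·-monoʳ x≤x′) (≤-reflexive (·.comm y′ x′))))

  x·y≤x : ∀ x y → x · y ≤ x
  x·y≤x x y = ≤-trans (·-monoʳ (to LatLeq⇔≤ (integral y))) (≤-reflexive (·.identityʳ x))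

  ·≗∧ : ∀ x y → x · y ≡ x ∧ y
  ·≗∧ x y = antisym
    (∧-greatest (x·y≤x x y) (≤-trans (≤-reflexive (·.comm x y)) (x·y≤x y x)))
    (≤-trans (≤-reflexive (sym (·-idem (x ∧ y)))) (·-monotonic (x∧y≤x x y) (x∧y≤y x y)))

  ∧-distribˡ-∨ : ∀ x y z → x ∧ (y ∨ z) ≡ (x ∧ y) ∨ (x ∧ z)
  ∧-distribˡ-∨ x y z = begin
    x ∧ (y ∨ z)        ≡⟨ ·≗∧ x (y ∨ z) ⟨
    x · (y ∨ z)        ≡⟨ ·-distrib-∨ x y z ⟩
    (x · y) ∨ (x · z)  ≡⟨ cong₂ _∨_ (·≗∧ x y) (·≗∧ x z) ⟩
    (x ∧ y) ∨ (x ∧ z)  ∎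
    where open ≡-Reasoning

  open Distributive ∧-distribˡ-∨

  residuation : ∀ x y z → LatLeq _∧_ (x ∧ y) z ⇔ LatLeq _∧_ y (x ⇒ z)
  residuation x y z = subst (λ t → LatLeq _∧_ t z ⇔ LatLeq _∧_ y (x ⇒ z)) (·≗∧ x y) (residuated x y z)

  open Residuated residuation

  +-monoʳ : ∀ {x y y′} → y ≤ y′ → x + y ≤ x + y′
  +-monoʳ {x} {y} {y′} y≤y′ = trans (cong (x +_) y≤y′) (+-distrib-∧ x y y′)

  +-monotonic : ∀ {x x′ y y′} → x ≤ x′ → y ≤ y′ → x + y ≤ x′ + y′
  +-monotonic {x} {x′} {y} {y′} x≤x′ y≤y′ = ≤-trans (+-monoʳ y≤y′)
    (≤-trans (≤-reflexive (+.comm x y′)) (≤-trans (+-monoʳ x≤x′) (≤-reflexive (+.comm y′ x′))))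

  ∧-+-hemidistrib : ∀ x y z → x ∧ (y + z) ≤ (x ∧ y) + z
  ∧-+-hemidistrib x y z = subst₂ (λ s t → s ≤ t + z) (·≗∧ x (y + z)) (·≗∧ x y)
    (to LatLeq⇔≤ (hemidistributive x y z))

  0∧x+y≤x : ∀ x y → 0# ∧ (x + y) ≤ x
  0∧x+y≤x x y = begin
    0# ∧ (x + y)          ≤⟨ ∧-greatest (x∧y≤x 0# (x + y)) (∧-+-hemidistrib 0# x y) ⟩
    0# ∧ ((0# ∧ x) + y)   ≡⟨ cong (0# ∧_) (+.comm (0# ∧ x) y) ⟩
    0# ∧ (y + (0# ∧ x))   ≤⟨ ∧-+-hemidistrib 0# y (0# ∧ x) ⟩
    (0# ∧ y) + (0# ∧ x)   ≤⟨ +-monotonic (x∧y≤x 0# y) ≤-refl ⟩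
    0# + (0# ∧ x)         ≡⟨ +.identityˡ (0# ∧ x) ⟩
    0# ∧ x                ≤⟨ x∧y≤y 0# x ⟩
    x                     ∎
    where open PosetReasoning poset

  0∧x+y≤x∧y : ∀ x y → 0# ∧ (x + y) ≤ x ∧ y
  0∧x+y≤x∧y x y = ∧-greatest (0∧x+y≤x x y)
    (≤-trans (≤-reflexive (cong (0# ∧_) (+.comm x y))) (0∧x+y≤x y x))

  ∧≤+ : ∀ {x y z} → z ∧ 0# ≤ y → z ∧ x ≤ y + x
  ∧≤+ {x} {y} {z} z∧0≤y = begin
    z ∧ x          ≡⟨ cong (z ∧_) (+.identityˡ x) ⟨
    z ∧ (0# + x)   ≤⟨ ∧-+-hemidistrib z 0# x ⟩
    (z ∧ 0#) + x   ≤⟨ +-monotonic z∧0≤y ≤-refl ⟩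
    y + x          ∎
    where open PosetReasoning poset

  +≗brPlus : ∀ x y → x + y ≡ brPlus _∨_ _∧_ _⇒_ 0# x y
  +≗brPlus x y = antisym
    (∧-greatest (transpose-⇒ (0∧x+y≤x∧y x y)) (begin
      x + y              ≤⟨ +-monotonic (x≤x∨y x y) (y≤x∨y x y) ⟩
      (x ∨ y) + (x ∨ y)  ≡⟨ +-idem (x ∨ y) ⟩
      x ∨ y              ∎))
    (≤∨-split (x∧y≤y q (x ∨ y))
      (≤-trans (∧-monotonic (x∧y≤x q (x ∨ y)) ≤-refl)
               (≤-trans (∧≤+ (≤-trans q∧0≤x∧y (x∧y≤y x y))) (≤-reflexive (+.comm y x))))
      (≤-trans (∧-monotonic (x∧y≤x q (x ∨ y)) ≤-refl) (∧≤+ (≤-trans q∧0≤x∧y (x∧y≤x x y)))))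
    where
    open PosetReasoning poset
    q : A
    q = 0# ⇒ (x ∧ y)
    q∧0≤x∧y : q ∧ 0# ≤ x ∧ y
    q∧0≤x∧y = ≤-trans (≤-reflexive (∧-comm q 0#)) (transpose-∧ ≤-refl)

  isPointedBrouwerian : IsPointedBrouwerian _∨_ _∧_ one _⇒_ 0#
  isPointedBrouwerian = record
    { isDistributiveLattice = ∧-distribˡ-∨⇒isDistributiveLattice ∧-distribˡ-∨
    ; top = integral
    ; residuation = residuation
    }

mainTheorem2 : ∀ {a : Level} {A : Set a} (_∨_ _∧_ _⇒_ : Op₂ A) (one zero : A) →
    (IsPointedBrouwerian _∨_ _∧_ one _⇒_ zero →
       IsMIICRLBimonoid _∨_ _∧_ (brTimes _∧_) one (brPlus _∨_ _∧_ _⇒_ zero) zero _⇒_)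
    × (∀ (_·_ _+_ : Op₂ A) →
         IsMIICRLBimonoid _∨_ _∧_ _·_ one _+_ zero _⇒_ →
           IsPointedBrouwerian _∨_ _∧_ one _⇒_ zero
           × (∀ x y → x · y ≡ brTimes _∧_ x y)
           × (∀ x y → x + y ≡ brPlus _∨_ _∧_ _⇒_ zero x y))
mainTheorem2 _∨_ _∧_ _⇒_ one zero =
  PointedBrouwerian.isMIICRLBimonoid ,
  λ _·_ _+_ M →
    MIICRLBimonoid.isPointedBrouwerian M , MIICRLBimonoid.·≗∧ M , MIICRLBimonoid.+≗brPlus M
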